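{- For every $\alpha\leq\omega$, the relation $\mathcal{M}^{\alpha}$ on closed $\mu$TCL terms is a congruence on the term algebra; that is, for every operation symbol $\mathsf{f}\colon \tau_1\times\cdots\times\tau_k\to\tau$ and closed terms $t_i,s_i$ of type $\tau_i$ with $\mathcal{M}^\alpha_{\tau_i}(t_i,s_i)$ ($i=1,\dots,k$), one has $\mathcal{M}^\alpha_\tau(\mathsf{f}(t_1,\dots,t_k),\mathsf{f}(s_1,\dots,s_k))$.
   Context: Types of $\mu$TCL: closed type expressions, modulo $\alpha$-equivalence, of the grammar $\tau::=\alpha\mid \tau_1\boxplus\tau_2\mid\tau_1\boxtimes\tau_2\mid \tau_1\Rightarrow\tau_2\mid \mu\alpha.\tau$. Closed terms are built from: constants $S_{\tau_1,\tau_2,\tau_3}\colon(\tau_1\Rightarrow\tau_2\Rightarrow\tau_3)\Rightarrow(\tau_1\Rightarrow\tau_2)\Rightarrow\tau_1\Rightarrow\tau_3$, $K_{\tau_1,\tau_2}\colon \tau_1\Rightarrow\tau_2\Rightarrow\tau_1$, $I_\tau\colon\tau\Rightarrow\tau$; operations $S'\colon(\tau_1\Rightarrow\tau_2\Rightarrow\tau_3)\to((\tau_1\Rightarrow\tau_2)\Rightarrow\tau_1\Rightarrow\tau_3)$, $S''\colon (\tau_1\Rightarrow\tau_2\Rightarrow\tau_3)\times(\tau_1\Rightarrow\tau_2)\to(\tau_1\Rightarrow\tau_3)$, $K'\colon\tau_1\to(\tau_2\Rightarrow\tau_1)$, application $t\,s$ of type $\tau_2$ for $t\colon\tau_1\Rightarrow\tau_2$,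 $s\colon\tau_1$, $\mathsf{inl}\colon\tau_1\to\tau_1\boxplus\tau_2$, $\mathsf{inr}\colon\tau_2\to\tau_1\boxplus\tau_2$, $\mathsf{case}\colon(\tau_1\boxplus\tau_2)\times(\tau_1\Rightarrow\tau_3)\times(\tau_2\Rightarrow\tau_3)\to\tau_3$, $\mathsf{pair}\colon\tau_1\times\tau_2\to\tau_1\boxtimes\tau_2$, $\mathsf{fst}\colon\tau_1\boxtimes\tau_2\to\tau_1$, $\mathsf{snd}\colon\tau_1\boxtimes\tau_2\to\tau_2$, $\mathsf{fold}_\tau\colon\tau[\mu\alpha.\tau/\alpha]\to\mu\alpha.\tau$, $\mathsf{unfold}_\tau\colon\mu\alpha.\tau\to\tau[\mu\alpha.\tau/\alpha]$. Transitions are exactly those derivable by: $S\xrightarrow{e}S'(e)$; $S'(t)\xrightarrow{e}S''(t,e)$; $S''(t,s)\xrightarrow{e}(t\,e)(s\,e)$; $K\xrightarrow{e}K'(e)$; $K'(t)\xrightarrow{e}t$; $I\xrightarrow{e}e$; $t\to t'\Rightarrow t\,s\to t'\,s$; $t\xrightarrow{s}t'\Rightarrow t\,s\to t'$; $\mathsf{inl}(t)\xrightarrow{\boxplus_1}t$; $\mathsf{inr}(t)\xrightarrow{\boxplus_2}t$; $t\to t'\Rightarrow\mathsf{case}(t,s,r)\to\mathsf{case}(t',s,r)$; $t\xrightarrow{\boxplus_1}t'\Rightarrow\mathsf{case}(t,s,r)\to s\,t'$; $t\xrightarrow{\boxplus_2}t'\Rightarrow\mathsf{case}(t,s,r)\to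 r\,t'$; $\mathsf{pair}(t,s)\xrightarrow{\boxtimes_1}t$; $\mathsf{pair}(t,s)\xrightarrow{\boxtimes_2}s$; $t\to t'\Rightarrow\mathsf{fst}(t)\to\mathsf{fst}(t'),\ \mathsf{snd}(t)\to\mathsf{snd}(t')$; $t\xrightarrow{\boxtimes_1}t'\Rightarrow\mathsf{fst}(t)\to t'$; $t\xrightarrow{\boxtimes_2}t'\Rightarrow\mathsf{snd}(t)\to t'$; $\mathsf{fold}(t)\xrightarrow{\mu}t$; $t\to t'\Rightarrow\mathsf{unfold}(t)\to\mathsf{unfold}(t')$; $t\xrightarrow{\mu}t'\Rightarrow\mathsf{unfold}(t)\to t'$. $\Rightarrow$ is the reflexive transitive closure of $\to$; $t\overset{l}{\Rightarrow}s$ iff $t\Rightarrow t'\xrightarrow{l}s$ for some $t'$. Extended weak transitions: for $t,s$ of type $\tau_1\Rightarrow\tau_2$ and $e$ of type $\tau_1$, $t\overset{e}{\Rrightarrow}s$ iff there is $t'$ with $t\Rightarrow t'$ and ($t'\xrightarrow{e}s$ or $s=t'\,e$); for all other labels $l\in\{\boxplus_1,\boxplus_2,\boxtimes_1,\boxtimes_2,\mu\}$, $t\overset{l}{\Rrightarrow}s$ iff $t\overset{l}{\Rightarrow}s$. For type-indexed relations $Q,R$: $\mathcal{E}(R)_\tau=\{(t,s)\mid t\to t'\implies\exists s'.\,s\Rightarrow s'\wedge R_\tau(t',s')\}$; $\mathcal{V}'_{\tau_1\boxplus\tau_2}(Q,R)=\{(t,s)\mid$ for $i=1,2$: $t\xrightarrow{\boxplus_i}t'\implies\exists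 s'.\,s\overset{\boxplus_i}{\Rrightarrow}s'\wedge R_{\tau_i}(t',s')\}$; $\mathcal{V}'_{\tau_1\boxtimes\tau_2}(Q,R)=\{(t,s)\mid t\xrightarrow{\boxtimes_1}t_1\wedge t\xrightarrow{\boxtimes_2}t_2\implies \exists s_1,s_2.\,s\overset{\boxtimes_1}{\Rrightarrow}s_1\wedge s\overset{\boxtimes_2}{\Rrightarrow}s_2\wedge R_{\tau_1}(t_1,s_1)\wedge R_{\tau_2}(t_2,s_2)\}$; $\mathcal{V}'_{\tau_1\Rightarrow\tau_2}(Q,R)=\{(t,s)\mid\forall e_1,e_2.\,Q_{\tau_1}(e_1,e_2)\wedge t\xrightarrow{e_1}t'\implies\exists s'.\,s\overset{e_2}{\Rrightarrow}s'\wedge R_{\tau_2}(t',s')\}$; $\mathcal{V}'_{\mu\alpha.\tau}(Q,R)=\{(t,s)\mid t\xrightarrow{\mu}t'\implies\exists s'.\,s\overset{\mu}{\Rrightarrow}s'\wedge R_{\tau[\mu\alpha.\tau/\alpha]}(t',s')\}$. $\mathcal{M}^0$ is the full relation, $\mathcal{M}^{n+1}=\mathcal{M}^n\cap\mathcal{E}(\mathcal{M}^n)\cap\mathcal{V}'(\mathcal{M}^n,\mathcal{M}^n)$, $\mathcal{M}^\omega=\bigcap_{n<\omega}\mathcal{M}^n$. -}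

module Defs where

open import Data.Nat using (ℕ; zero; suc)
open import Data.Fin using (Fin; zero; suc)
open import Data.List using (List; []; _∷_)
open import Data.List.Relation.Unary.All using (All; []; _∷_)
open import Data.Product using (∃; ∃₂; _×_; _,_)
open import Data.Sum using (_⊎_)
open import Data.Unit using (⊤)
open import Relation.Binary.PropositionalEquality using (_≡_)
open import Relation.Binary.Construct.Closure.ReflexiveTransitive using (Star)

-- Types of μTCL: de Bruijn type expressions (so α-equivalence is equality).
-- Ty n = type expressions with at most n free type variables.

infixr 7 _⇒_
infixr 8 _⊞_ _⊠_

data Ty (n : ℕ) : Set where
  var  : Fin n → Ty n
  _⊞_  : Ty n → Ty n → Ty n
  _⊠_  : Ty n → Ty n → Ty n
  _⇒_  : Ty n → Ty n → Ty n
  μ    : Ty (suc n) → Ty n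

Type : Set
Type = Ty 0

ext : ∀ {n m} → (Fin n → Fin m) → Fin (suc n) → Fin (suc m)
ext ρ zero    = zero
ext ρ (suc i) = suc (ρ i)

ren : ∀ {n m} → (Fin n → Fin m) → Ty n → Ty m
ren ρ (var i)   = var (ρ i)
ren ρ (a ⊞ b)   = ren ρ a ⊞ ren ρ b
ren ρ (a ⊠ b)   = ren ρ a ⊠ ren ρ b
ren ρ (a ⇒ b)   = ren ρ a ⇒ ren ρ b
ren ρ (μ a)     = μ (ren (ext ρ) a)

exts : ∀ {n m} → (Fin n → Ty m) → Fin (suc n) → Ty (suc m)
exts σ zero    = var zero
exts σ (suc i) = ren suc (σ i)

sub : ∀ {n m} → (Fin n → Ty m) → Ty n → Ty m
sub σ (var i)  = σ i
sub σ (a ⊞ b)  = sub σ a ⊞ sub σ b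
sub σ (a ⊠ b)  = sub σ a ⊠ sub σ b
sub σ (a ⇒ b)  = sub σ a ⇒ sub σ b
sub σ (μ a)    = μ (sub (exts σ) a)

single : Type → Fin 1 → Type
single σ zero = σ

_[_]₀ : Ty 1 → Type → Type
τ [ σ ]₀ = sub (single σ) τ

unroll : Ty 1 → Type
unroll τ = τ [ μ τ ]₀

infixl 9 _·_

data Tm : Type → Set where
  S      : ∀ {a b c} → Tm ((a ⇒ b ⇒ c) ⇒ (a ⇒ b) ⇒ a ⇒ c)
  K      : ∀ {a b} → Tm (a ⇒ b ⇒ a)
  I      : ∀ {a} → Tm (a ⇒ a)
  S′     : ∀ {a b c} → Tm (a ⇒ b ⇒ c) → Tm ((a ⇒ b) ⇒ a ⇒ c)
  S″     : ∀ {a b c} → Tm (a ⇒ b ⇒ c) → Tm (a ⇒ b) → Tm (a ⇒ c)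
  K′     : ∀ {a b} → Tm a → Tm (b ⇒ a)
  _·_    : ∀ {a b} → Tm (a ⇒ b) → Tm a → Tm b
  inl    : ∀ {a b} → Tm a → Tm (a ⊞ b)
  inr    : ∀ {a b} → Tm b → Tm (a ⊞ b)
  case   : ∀ {a b c} → Tm (a ⊞ b) → Tm (a ⇒ c) → Tm (b ⇒ c) → Tm c
  pair   : ∀ {a b} → Tm a → Tm b → Tm (a ⊠ b)
  fst    : ∀ {a b} → Tm (a ⊠ b) → Tm a
  snd    : ∀ {a b} → Tm (a ⊠ b) → Tm b
  fold   : ∀ {τ} → Tm (unroll τ) → Tm (μ τ)
  unfold : ∀ {τ} → Tm (μ τ) → Tm (unroll τ)

data Label : Type → Type → Set where
  arg : ∀ {a b} → Tm a → Label (a ⇒ b) b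
  ⊞₁  : ∀ {a b} → Label (a ⊞ b) a
  ⊞₂  : ∀ {a b} → Label (a ⊞ b) b
  ⊠₁  : ∀ {a b} → Label (a ⊠ b) a
  ⊠₂  : ∀ {a b} → Label (a ⊠ b) b
  μl  : ∀ {τ} → Label (μ τ) (unroll τ)

infix 4 _—[_]→_ _=[_]⇒_ _⇛[_]_
data _—[_]→_ : ∀ {σ τ} → Tm σ → Label σ τ → Tm τ → Set where
  S-step  : ∀ {a b c} {e : Tm (a ⇒ b ⇒ c)} → S —[ arg e ]→ S′ e
  S′-step : ∀ {a b c} {t : Tm (a ⇒ b ⇒ c)} {e} → S′ t —[ arg e ]→ S″ t e
  S″-step : ∀ {a b c} {t : Tm (a ⇒ b ⇒ c)} {s} {e} →
            S″ t s —[ arg e ]→ (t · e) · (s · e)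
  K-step  : ∀ {a b} {e : Tm a} → K {a} {b} —[ arg e ]→ K′ e
  K′-step : ∀ {a b} {t : Tm a} {e : Tm b} → K′ t —[ arg e ]→ t
  I-step  : ∀ {a} {e : Tm a} → I —[ arg e ]→ e
  inl-step  : ∀ {a b} {t : Tm a} → inl {a} {b} t —[ ⊞₁ ]→ t
  inr-step  : ∀ {a b} {t : Tm b} → inr {a} {b} t —[ ⊞₂ ]→ t
  pair-step₁ : ∀ {a b} {t : Tm a} {s : Tm b} → pair t s —[ ⊠₁ ]→ t
  pair-step₂ : ∀ {a b} {t : Tm a} {s : Tm b} → pair t s —[ ⊠₂ ]→ s
  fold-step : ∀ {τ} {t : Tm (unroll τ)} → fold {τ} t —[ μl ]→ t

infix 4 _⟶_
data _⟶_ : ∀ {τ} → Tm τ → Tm τ → Set where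
  app-cong : ∀ {a b} {t t′ : Tm (a ⇒ b)} {s} → t ⟶ t′ → t · s ⟶ t′ · s
  app-β    : ∀ {a b} {t : Tm (a ⇒ b)} {s t′} → t —[ arg s ]→ t′ → t · s ⟶ t′
  case-cong : ∀ {a b c} {t t′ : Tm (a ⊞ b)} {s : Tm (a ⇒ c)} {r} →
              t ⟶ t′ → case t s r ⟶ case t′ s r
  case-β₁  : ∀ {a b c} {t : Tm (a ⊞ b)} {t′} {s : Tm (a ⇒ c)} {r} →
              t —[ ⊞₁ ]→ t′ → case t s r ⟶ s · t′
  case-β₂  : ∀ {a b c} {t : Tm (a ⊞ b)} {t′} {s : Tm (a ⇒ c)} {r} →
              t —[ ⊞₂ ]→ t′ → case t s r ⟶ r · t′
  fst-cong : ∀ {a b} {t t′ : Tm (a ⊠ b)} → t ⟶ t′ → fst t ⟶ fst t′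
  snd-cong : ∀ {a b} {t t′ : Tm (a ⊠ b)} → t ⟶ t′ → snd t ⟶ snd t′
  fst-β    : ∀ {a b} {t : Tm (a ⊠ b)} {t′} → t —[ ⊠₁ ]→ t′ → fst t ⟶ t′
  snd-β    : ∀ {a b} {t : Tm (a ⊠ b)} {t′} → t —[ ⊠₂ ]→ t′ → snd t ⟶ t′
  unfold-cong : ∀ {τ} {t t′ : Tm (μ τ)} → t ⟶ t′ → unfold t ⟶ unfold t′
  unfold-β    : ∀ {τ} {t : Tm (μ τ)} {t′} → t —[ μl ]→ t′ → unfold t ⟶ t′

infix 4 _⟹_
_⟹_ : ∀ {τ} → Tm τ → Tm τ → Set
_⟹_ {τ} = Star (_⟶_ {τ})

_=[_]⇒_ : ∀ {σ τ} → Tm σ → Label σ τ → Tm τ → Set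
t =[ l ]⇒ s = ∃ λ t′ → t ⟹ t′ × t′ —[ l ]→ s

_⇛[_]_ : ∀ {σ τ} → Tm σ → Label σ τ → Tm τ → Set
t ⇛[ arg e ] s = ∃ λ t′ → t ⟹ t′ × (t′ —[ arg e ]→ s ⊎ s ≡ t′ · e)
t ⇛[ ⊞₁ ] s = t =[ ⊞₁ ]⇒ s
t ⇛[ ⊞₂ ] s = t =[ ⊞₂ ]⇒ s
t ⇛[ ⊠₁ ] s = t =[ ⊠₁ ]⇒ s
t ⇛[ ⊠₂ ] s = t =[ ⊠₂ ]⇒ s
t ⇛[ μl ] s = t =[ μl ]⇒ s

TRel : Set₁
TRel = ∀ τ → Tm τ → Tm τ → Set

E : TRel → TRel
E R τ t s = ∀ {t′} → t ⟶ t′ → ∃ λ s′ → s ⟹ s′ × R τ t′ s′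

V′ : TRel → TRel → TRel
V′ Q R (var ())
V′ Q R (a ⊞ b) t s =
  (∀ {t′} → t —[ ⊞₁ ]→ t′ → ∃ λ s′ → s ⇛[ ⊞₁ ] s′ × R a t′ s′) ×
  (∀ {t′} → t —[ ⊞₂ ]→ t′ → ∃ λ s′ → s ⇛[ ⊞₂ ] s′ × R b t′ s′)
V′ Q R (a ⊠ b) t s =
  ∀ {t₁ t₂} → t —[ ⊠₁ ]→ t₁ → t —[ ⊠₂ ]→ t₂ →
  ∃₂ λ s₁ s₂ → s ⇛[ ⊠₁ ] s₁ × s ⇛[ ⊠₂ ] s₂ × R a t₁ s₁ × R b t₂ s₂
V′ Q R (a ⇒ b) t s =
  ∀ {e₁ e₂ t′} → Q a e₁ e₂ → t —[ arg e₁ ]→ t′ →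
  ∃ λ s′ → s ⇛[ arg e₂ ] s′ × R b t′ s′
V′ Q R (μ τ) t s =
  ∀ {t′} → t —[ μl ]→ t′ → ∃ λ s′ → s ⇛[ μl ] s′ × R (unroll τ) t′ s′

M : ℕ → TRel
M zero    τ t s = ⊤
M (suc n) τ t s = M n τ t s × E (M n) τ t s × V′ (M n) (M n) τ t s

Mω : TRel
Mω τ t s = ∀ n → M n τ t s

data Ord≤ω : Set where
  fin : ℕ → Ord≤ω
  ω   : Ord≤ω

M^ : Ord≤ω → TRel
M^ (fin n) = M n
M^ ω       = Mω

data Op : List Type → Type → Set where
  S-op      : ∀ a b c → Op [] ((a ⇒ b ⇒ c) ⇒ (a ⇒ b) ⇒ a ⇒ c)
  K-op      : ∀ a b → Op [] (a ⇒ b ⇒ a)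
  I-op      : ∀ a → Op [] (a ⇒ a)
  S′-op     : ∀ a b c → Op ((a ⇒ b ⇒ c) ∷ []) ((a ⇒ b) ⇒ a ⇒ c)
  S″-op     : ∀ a b c → Op ((a ⇒ b ⇒ c) ∷ (a ⇒ b) ∷ []) (a ⇒ c)
  K′-op     : ∀ a b → Op (a ∷ []) (b ⇒ a)
  app-op    : ∀ a b → Op ((a ⇒ b) ∷ a ∷ []) b
  inl-op    : ∀ a b → Op (a ∷ []) (a ⊞ b)
  inr-op    : ∀ a b → Op (b ∷ []) (a ⊞ b)
  case-op   : ∀ a b c → Op ((a ⊞ b) ∷ (a ⇒ c) ∷ (b ⇒ c) ∷ []) c
  pair-op   : ∀ a b → Op (a ∷ b ∷ []) (a ⊠ b)
  fst-op    : ∀ a b → Op ((a ⊠ b) ∷ []) a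
  snd-op    : ∀ a b → Op ((a ⊠ b) ∷ []) b
  fold-op   : ∀ τ → Op (unroll τ ∷ []) (μ τ)
  unfold-op : ∀ τ → Op (μ τ ∷ []) (unroll τ)

Args : List Type → Set
Args = All Tm

apply : ∀ {τs τ} → Op τs τ → Args τs → Tm τ
apply (S-op a b c) [] = S
apply (K-op a b) [] = K
apply (I-op a) [] = I
apply (S′-op a b c) (t ∷ []) = S′ t
apply (S″-op a b c) (t ∷ s ∷ []) = S″ t s
apply (K′-op a b) (t ∷ []) = K′ t
apply (app-op a b) (t ∷ s ∷ []) = t · s
apply (inl-op a b) (t ∷ []) = inl t
apply (inr-op a b) (t ∷ []) = inr t
apply (case-op a b c) (t ∷ s ∷ r ∷ []) = case t s r
apply (pair-op a b) (t ∷ s ∷ []) = pair t s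
apply (fst-op a b) (t ∷ []) = fst t
apply (snd-op a b) (t ∷ []) = snd t
apply (fold-op τ) (t ∷ []) = fold t
apply (unfold-op τ) (t ∷ []) = unfold t

data Pointwise (R : TRel) : ∀ {τs} → Args τs → Args τs → Set where
  []  : Pointwise R [] []
  _∷_ : ∀ {τ τs} {t s : Tm τ} {ts ss : Args τs} →
        R τ t s → Pointwise R ts ss → Pointwise R (t ∷ ts) (s ∷ ss)

Congruence : TRel → Set
Congruence R = ∀ {τs τ} (f : Op τs τ) {ts ss : Args τs} →
               Pointwise R ts ss → R τ (apply f ts) (apply f ss)

module Submission where

open import Defs
open import Data.Nat using (ℕ; zero; suc)
open import Data.List.Relation.Unary.All using ([]; _∷_)
open import Data.Product using (_,_; proj₁)
open import Data.Sum using (inj₁; inj₂)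
open import Data.Unit using (tt)
open import Data.Empty using (⊥; ⊥-elim)
open import Relation.Binary.PropositionalEquality using (refl)
open import Relation.Binary.Construct.Closure.ReflexiveTransitive using (ε; _◅◅_; gmap; return)

-- By induction on n, M (suc n) is a congruence once M n is.  A term built by an
-- operation either only makes labelled transitions (combinators and introduction
-- forms) or only silent ones (elimination forms).  A labelled transition of
-- f(t⃗) is matched by the same transition of f(s⃗), whose residuals are again
-- built by operations from M n-related parts, hence related by the hypothesis.
-- A silent transition of an elimination form either reduces the principal
-- argument, answered via the E-clause of that argument, or contracts a redex,
-- answered via its V′-clause: the weak transition of the partner lifts through
-- the evaluation context.

Pointwise-map : ∀ {R Q : TRel} → (∀ {τ t s} → R τ t s → Q τ t s) →
                ∀ {τs} {ts ss : Args τs} → Pointwise R ts ss → Pointwise Q ts ss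
Pointwise-map f []       = []
Pointwise-map f (r ∷ rs) = f r ∷ Pointwise-map f rs

M-suc⇒M : ∀ {n τ t s} → M (suc n) τ t s → M n τ t s
M-suc⇒M = proj₁

Inert : ∀ {τ} → Tm τ → Set
Inert {τ} t = ∀ {σ} {l : Label τ σ} {u} → t —[ l ]→ u → ⊥

V′-inert : ∀ {Q R} τ {t s : Tm τ} → Inert t → V′ Q R τ t s
V′-inert (var ())
V′-inert (a ⊞ b) inert = (λ st → ⊥-elim (inert st)) , (λ st → ⊥-elim (inert st))
V′-inert (a ⊠ b) inert = λ st _ → ⊥-elim (inert st)
V′-inert (a ⇒ b) inert = λ _ st → ⊥-elim (inert st)
V′-inert (μ τ)   inert = λ st → ⊥-elim (inert st)

contract : ∀ {σ ρ τ} {l : Label σ ρ} (f : Tm σ → Tm τ) {g : Tm ρ → Tm τ} →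
           (∀ {x y} → x ⟶ y → f x ⟶ f y) → (∀ {x y} → x —[ l ]→ y → f x ⟶ g y) →
           ∀ {x y} → x =[ l ]⇒ y → f x ⟹ g y
contract f cong β (_ , x⟹x₀ , x₀→y) = gmap f cong x⟹x₀ ◅◅ return (β x₀→y)

apply-⇛ : ∀ {a b} {t : Tm (a ⇒ b)} {e u} → t ⇛[ arg e ] u → t · e ⟹ u
apply-⇛ (_ , t⟹t₀ , inj₁ t₀→u) = contract (_· _) app-cong app-β (_ , t⟹t₀ , t₀→u)
apply-⇛ (_ , t⟹t₀ , inj₂ refl) = gmap (_· _) app-cong t⟹t₀

module _ (n : ℕ) (M-cong : Congruence (M n)) where

  app-E : ∀ {a b} {t t′ : Tm (a ⇒ b)} {s s′} → M (suc n) _ t t′ → M (suc n) _ s s′ →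
          E (M n) b (t · s) (t′ · s′)
  app-E (_ , e , _) ms (app-cong st) with e st
  ... | u , t′⟹u , mu = u · _ , gmap (_· _) app-cong t′⟹u ,
                        M-cong (app-op _ _) (mu ∷ M-suc⇒M ms ∷ [])
  app-E (_ , _ , v) ms (app-β st) with v (M-suc⇒M ms) st
  ... | u , t′⇛u , mu = u , apply-⇛ t′⇛u , mu

  case-E : ∀ {a b c} {t t′ : Tm (a ⊞ b)} {s s′ : Tm (a ⇒ c)} {r r′} →
           M (suc n) _ t t′ → M (suc n) _ s s′ → M (suc n) _ r r′ →
           E (M n) c (case t s r) (case t′ s′ r′)
  case-E (_ , e , _) ms mr (case-cong st) with e st
  ... | u , t′⟹u , mu = case u _ _ , gmap (λ x → case x _ _) case-cong t′⟹u ,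
                        M-cong (case-op _ _ _) (mu ∷ M-suc⇒M ms ∷ M-suc⇒M mr ∷ [])
  case-E (_ , _ , v₁ , _) ms mr (case-β₁ st) with v₁ st
  ... | u , t′⇒u , mu = _ · u , contract (λ x → case x _ _) case-cong case-β₁ t′⇒u ,
                        M-cong (app-op _ _) (M-suc⇒M ms ∷ mu ∷ [])
  case-E (_ , _ , _ , v₂) ms mr (case-β₂ st) with v₂ st
  ... | u , t′⇒u , mu = _ · u , contract (λ x → case x _ _) case-cong case-β₂ t′⇒u ,
                        M-cong (app-op _ _) (M-suc⇒M mr ∷ mu ∷ [])

  fst-E : ∀ {a b} {t t′ : Tm (a ⊠ b)} → M (suc n) _ t t′ → E (M n) a (fst t) (fst t′)
  fst-E (_ , e , _) (fst-cong st) with e st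
  ... | u , t′⟹u , mu = fst u , gmap fst fst-cong t′⟹u , M-cong (fst-op _ _) (mu ∷ [])
  fst-E (_ , _ , v) (fst-β pair-step₁) with v pair-step₁ pair-step₂
  ... | u , _ , t′⇒u , _ , mu , _ = u , contract fst fst-cong fst-β t′⇒u , mu

  snd-E : ∀ {a b} {t t′ : Tm (a ⊠ b)} → M (suc n) _ t t′ → E (M n) b (snd t) (snd t′)
  snd-E (_ , e , _) (snd-cong st) with e st
  ... | u , t′⟹u , mu = snd u , gmap snd snd-cong t′⟹u , M-cong (snd-op _ _) (mu ∷ [])
  snd-E (_ , _ , v) (snd-β pair-step₂) with v pair-step₁ pair-step₂
  ... | _ , u , _ , t′⇒u , _ , mu = u , contract snd snd-cong snd-β t′⇒u , mu

  unfold-E : ∀ {τ} {t t′ : Tm (μ τ)} → M (suc n) _ t t′ → E (M n) (unroll τ) (unfold t) (unfold t′)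
  unfold-E (_ , e , _) (unfold-cong st) with e st
  ... | u , t′⟹u , mu = unfold u , gmap unfold unfold-cong t′⟹u ,
                        M-cong (unfold-op _) (mu ∷ [])
  unfold-E (_ , _ , v) (unfold-β st) with v st
  ... | u , t′⇒u , mu = u , contract unfold unfold-cong unfold-β t′⇒u , mu

  apply-E : ∀ {τs τ} (f : Op τs τ) {ts ss : Args τs} → Pointwise (M (suc n)) ts ss →
            E (M n) τ (apply f ts) (apply f ss)
  apply-E (S-op a b c)    []                 ()
  apply-E (K-op a b)      []                 ()
  apply-E (I-op a)        []                 ()
  apply-E (S′-op a b c)   (_ ∷ [])           ()
  apply-E (S″-op a b c)   (_ ∷ _ ∷ [])       ()
  apply-E (K′-op a b)     (_ ∷ [])           ()
  apply-E (app-op a b)    (mt ∷ ms ∷ [])     = app-E mt ms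
  apply-E (inl-op a b)    (_ ∷ [])           ()
  apply-E (inr-op a b)    (_ ∷ [])           ()
  apply-E (case-op a b c) (mt ∷ ms ∷ mr ∷ []) = case-E mt ms mr
  apply-E (pair-op a b)   (_ ∷ _ ∷ [])       ()
  apply-E (fst-op a b)    (mt ∷ [])          = fst-E mt
  apply-E (snd-op a b)    (mt ∷ [])          = snd-E mt
  apply-E (fold-op τ)     (_ ∷ [])           ()
  apply-E (unfold-op τ)   (mt ∷ [])          = unfold-E mt

  apply-V′ : ∀ {τs τ} (f : Op τs τ) {ts ss : Args τs} → Pointwise (M (suc n)) ts ss →
             V′ (M n) (M n) τ (apply f ts) (apply f ss)
  apply-V′ (S-op a b c) [] me S-step =
    _ , (_ , ε , inj₁ S-step) , M-cong (S′-op _ _ _) (me ∷ [])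
  apply-V′ (K-op a b) [] me K-step =
    _ , (_ , ε , inj₁ K-step) , M-cong (K′-op _ _) (me ∷ [])
  apply-V′ (I-op a) [] me I-step = _ , (_ , ε , inj₁ I-step) , me
  apply-V′ (S′-op a b c) (mt ∷ []) me S′-step =
    _ , (_ , ε , inj₁ S′-step) , M-cong (S″-op _ _ _) (M-suc⇒M mt ∷ me ∷ [])
  apply-V′ (S″-op a b c) (mt ∷ ms ∷ []) me S″-step =
    _ , (_ , ε , inj₁ S″-step) ,
    M-cong (app-op _ _) (M-cong (app-op _ _) (M-suc⇒M mt ∷ me ∷ []) ∷
                               M-cong (app-op _ _) (M-suc⇒M ms ∷ me ∷ []) ∷ [])
  apply-V′ (K′-op a b) (mt ∷ []) me K′-step = _ , (_ , ε , inj₁ K′-step) , M-suc⇒M mt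
  apply-V′ (app-op a b) (_ ∷ _ ∷ []) = V′-inert b λ ()
  apply-V′ (inl-op a b) (mt ∷ []) =
    (λ { inl-step → _ , (_ , ε , inl-step) , M-suc⇒M mt }) , λ ()
  apply-V′ (inr-op a b) (mt ∷ []) =
    (λ ()) , λ { inr-step → _ , (_ , ε , inr-step) , M-suc⇒M mt }
  apply-V′ (case-op a b c) (_ ∷ _ ∷ _ ∷ []) = V′-inert c λ ()
  apply-V′ (pair-op a b) (mt ∷ ms ∷ []) pair-step₁ pair-step₂ =
    _ , _ , (_ , ε , pair-step₁) , (_ , ε , pair-step₂) , M-suc⇒M mt , M-suc⇒M ms
  apply-V′ (fst-op a b) (_ ∷ []) = V′-inert a λ ()
  apply-V′ (snd-op a b) (_ ∷ []) = V′-inert b λ ()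
  apply-V′ (fold-op τ) (mt ∷ []) fold-step = _ , (_ , ε , fold-step) , M-suc⇒M mt
  apply-V′ (unfold-op τ) (_ ∷ []) = V′-inert (unroll τ) λ ()

  M-suc-congruence : Congruence (M (suc n))
  M-suc-congruence f ms = M-cong f (Pointwise-map M-suc⇒M ms) , apply-E f ms , apply-V′ f ms

M-congruence : ∀ n → Congruence (M n)
M-congruence zero    f _ = tt
M-congruence (suc n) = M-suc-congruence n (M-congruence n)

Mω-congruence : Congruence Mω
Mω-congruence f ms n = M-congruence n f (Pointwise-map (λ m → m n) ms)

theorem3p11 : (α : Ord≤ω) → Congruence (M^ α)
theorem3p11 (fin n) = M-congruence n
theorem3p11 ω       = Mω-congruence
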